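{- Let $n$ be an odd positive integer and let $\mathcal{B}$ be a balanced bipartite graph on $2n$ vertices with parts $V_1$ and $V_2$ (each of size $n$), and suppose $\delta(\mathcal{B})\geq \frac{n}{2}+1$. Let $S\subseteq V(\mathcal{B})$ with $|S|=n+1$. Then the induced subgraph $\mathcal{B}[S]$ is a forest if and only if $\min\{|S\cap V_1|,|S\cap V_2|\}=1$.
   Context: All graphs are finite and simple. A balanced bipartite graph on $2n$ vertices is a bipartite graph with bipartition $V_1,V_2$, $|V_1|=|V_2|=n$. $\delta(G)$ is the minimum degree and $G[S]$ is the subgraph induced by $S$. -}

module Defs where

open import Data.Nat using (ℕ; zero; suc; _+_; _*_; _≤_)
open import Data.Bool using (Bool; true; false)
open import Data.Fin using (Fin; zero; suc; inject₁; fromℕ)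
open import Data.Fin.Subset using (Subset; _∈_)
open import Data.Sum using (_⊎_; inj₁; inj₂)
open import Data.Product using (Σ; _×_)
open import Data.Empty using (⊥)
open import Relation.Binary.PropositionalEquality using (_≡_)
open import Relation.Nullary using (¬_)
open import Function.Definitions using (Injective)

-- A balanced bipartite graph on 2n vertices with parts V₁ = Fin n (tagged inj₁)
-- and V₂ = Fin n (tagged inj₂).  It is given by its bipartite adjacency:
-- adj a b = true iff a ∈ V₁ and b ∈ V₂ are adjacent.
BipGraph : ℕ → Set
BipGraph n = Fin n → Fin n → Bool

Vertex : ℕ → Set
Vertex n = Fin n ⊎ Fin n

Adj : ∀ {n} → BipGraph n → Vertex n → Vertex n → Set
Adj B (inj₁ a) (inj₂ b) = B a b ≡ true
Adj B (inj₂ b) (inj₁ a) = B a b ≡ true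
Adj B (inj₁ _) (inj₁ _) = ⊥
Adj B (inj₂ _) (inj₂ _) = ⊥

countTrue : ∀ {m} → (Fin m → Bool) → ℕ
countTrue {zero} f = 0
countTrue {suc m} f with f zero
... | true  = suc (countTrue (λ i → f (suc i)))
... | false = countTrue (λ i → f (suc i))

degree : ∀ {n} → BipGraph n → Vertex n → ℕ
degree B (inj₁ a) = countTrue (λ b → B a b)
degree B (inj₂ b) = countTrue (λ a → B a b)

MinDegreeAtLeastHalfPlusOne : ∀ {n} → BipGraph n → Set
MinDegreeAtLeastHalfPlusOne {n} B = ∀ v → n + 2 ≤ 2 * degree B v

-- A vertex subset S ⊆ V(B), given by S₁ = S ∩ V₁ and S₂ = S ∩ V₂.
InS : ∀ {n} → Subset n → Subset n → Vertex n → Set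
InS S₁ S₂ (inj₁ a) = a ∈ S₁
InS S₁ S₂ (inj₂ b) = b ∈ S₂

record CycleIn {n} (B : BipGraph n) (S₁ S₂ : Subset n) : Set where
  field
    k     : ℕ
    v     : Fin (suc (suc (suc k))) → Vertex n
    inj   : Injective _≡_ _≡_ v
    inS   : ∀ i → InS S₁ S₂ (v i)
    step  : ∀ (i : Fin (suc (suc k))) → Adj B (v (inject₁ i)) (v (suc i))
    close : Adj B (v (fromℕ (suc (suc k)))) (v zero)

IsForest : ∀ {n} → BipGraph n → Subset n → Subset n → Set
IsForest B S₁ S₂ = ¬ CycleIn B S₁ S₂

module Submission where

-- Write n = 2m + 1, and by the symmetry V₁ ↔ V₂ let a = |S ∩ V₁| ≤ b = |S ∩ V₂|, so a + b = 2m + 2.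
-- If a = 1, every cycle of B[S] would pass through a vertex of V₂ whose two cycle neighbours are
-- distinct vertices of S ∩ V₁; hence B[S] is a forest.  If a ≥ 2, each vertex of S ∩ V₁ has at least
-- m + 2 neighbours, of which at most n − b = a − 1 lie outside S, so B[S] has at least
-- a(m + 3 − a) ≥ 2m + 2 = |S| edges.  A graph with at least as many edges as vertices contains a
-- cycle: deleting a vertex with at most one neighbour preserves that inequality, and once every
-- vertex has two neighbours, a walk that never immediately returns must revisit a vertex.

open import Defs
open import Data.Bool using (Bool; true; false; not; _∧_; if_then_else_)
open import Data.Bool.Properties using (∧-conicalˡ; ∧-conicalʳ; ∧-comm; ∧-assoc) renaming (_≟_ to _≟ᵇ_)
open import Data.Empty using (⊥; ⊥-elim)
open import Data.Fin using (Fin; zero; suc; toℕ; inject₁; fromℕ)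
open import Data.Fin.Patterns using (0F; 1F; 2F)
open import Data.Fin.Properties
  using (toℕ-injective; toℕ-inject₁; toℕ-fromℕ; toℕ<n; pigeonhole; inj⇒≟; any?; +↔⊎) renaming (_≟_ to _≟ᶠ_)
open import Data.Fin.Subset using (Subset; ∣_∣)
open import Data.Nat using (ℕ; zero; suc; _+_; _*_; _≤_; _<_; _⊓_; _%_; _/_; z≤n; s≤s; s≤s⁻¹; _≤?_)
open import Data.Nat.DivMod using (m≡m%n+[m/n]*n)
open import Data.Nat.Properties
open import Data.Nat.Tactic.RingSolver using (solve-∀)
open import Algebra.Properties.CommutativeMonoid.Sum +-0-commutativeMonoid
  using (sum; sum-syntax; sum-cong-≗; sum-replicate-zero; ∑-distrib-+; ∑-comm)
open import Data.Product using (∃; ∃₂; _×_; _,_; proj₁; proj₂)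
open import Data.Sum using (_⊎_; inj₁; inj₂; swap; [_,_]′)
open import Data.Sum.Properties using (inj₁-injective; inj₂-injective; swap-↔)
open import Data.Vec using ([]; _∷_; lookup)
open import Data.Vec.Properties using ([]=⇒lookup; lookup⇒[]=)
open import Function using (_∘_; id; const; _↣_; _⇔_; mk⇔; Injection)
open import Function.Construct.Symmetry using (↔-sym)
open import Function.Definitions using (Injective)
open import Function.Properties.Inverse using (↔⇒↣)
open import Relation.Binary.PropositionalEquality
  using (_≡_; _≢_; refl; sym; trans; cong; subst; ≢-sym; module ≡-Reasoning)
open import Relation.Nullary using (¬_; does; yes; no; contradiction)
open import Relation.Nullary.Decidable using (_×-dec_; decidable-stable)

private variable n : ℕ

-- Sums and counts over Fin n

∑-mono-≤ : {f g : Fin n → ℕ} → (∀ i → f i ≤ g i) → sum f ≤ sum g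
∑-mono-≤ {zero}  f≤g = z≤n
∑-mono-≤ {suc n} f≤g = +-mono-≤ (f≤g zero) (∑-mono-≤ (f≤g ∘ suc))

∑∈ : (Fin n → Bool) → (Fin n → ℕ) → ℕ
∑∈ {n} s h = ∑[ i < n ] (if s i then h i else 0)

count : (Fin n → Bool) → ℕ
count s = ∑∈ s (const 1)

infixl 6 _-_
_-_ : (Fin n → Bool) → Fin n → Fin n → Bool
(s - x) i = if does (i ≟ᶠ x) then false else s i

∈-⇒∈ : ∀ (s : Fin n → Bool) x y → (s - x) y ≡ true → s y ≡ true
∈-⇒∈ s x y with y ≟ᶠ x
... | no _ = id

∈-⇒≢ : ∀ (s : Fin n → Bool) x y → (s - x) y ≡ true → y ≢ x
∈-⇒≢ s x y with y ≟ᶠ x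
... | no y≢x = const y≢x

∈∧≢⇒∈- : ∀ (s : Fin n → Bool) x y → s y ≡ true → y ≢ x → (s - x) y ≡ true
∈∧≢⇒∈- s x y sy y≢x with y ≟ᶠ x
... | yes y≡x = contradiction y≡x y≢x
... | no _    = sy

∑∈-remove : ∀ (s : Fin n → Bool) x h → s x ≡ true → ∑∈ s h ≡ ∑∈ (s - x) h + h x
∑∈-remove s zero    h s0 rewrite s0 = +-comm (h zero) _
∑∈-remove s (suc x) h sx = begin
  h₀ + ∑∈ (s ∘ suc) (h ∘ suc)                   ≡⟨ cong (h₀ +_) (∑∈-remove (s ∘ suc) x (h ∘ suc) sx) ⟩
  h₀ + (∑∈ (s ∘ suc - x) (h ∘ suc) + h (suc x)) ≡⟨ +-assoc h₀ _ (h (suc x)) ⟨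
  h₀ + ∑∈ (s ∘ suc - x) (h ∘ suc) + h (suc x)   ∎
  where
  open ≡-Reasoning
  h₀ = if s zero then h zero else 0

∑∈-mono-≤ : ∀ (s : Fin n → Bool) {g h} → (∀ i → s i ≡ true → g i ≤ h i) → ∑∈ s g ≤ ∑∈ s h
∑∈-mono-≤ s {g} {h} g≤h = ∑-mono-≤ pointwise
  where
  pointwise : ∀ i → (if s i then g i else 0) ≤ (if s i then h i else 0)
  pointwise i with s i in si
  ... | true  = g≤h i si
  ... | false = z≤n

∑∈-+ : ∀ (s : Fin n → Bool) g h → ∑∈ s (λ i → g i + h i) ≡ ∑∈ s g + ∑∈ s h
∑∈-+ s g h =
  trans (sum-cong-≗ pointwise) (∑-distrib-+ (λ i → if s i then g i else 0) (λ i → if s i then h i else 0))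
  where
  pointwise : ∀ i → (if s i then g i + h i else 0) ≡ (if s i then g i else 0) + (if s i then h i else 0)
  pointwise i with s i
  ... | true  = refl
  ... | false = refl

∑∈-const : ∀ (s : Fin n → Bool) c → ∑∈ s (const c) ≡ c * count s
∑∈-const {zero}  s c = sym (*-zeroʳ c)
∑∈-const {suc n} s c with s zero
... | true  = trans (cong (c +_) (∑∈-const (s ∘ suc) c)) (sym (*-suc c _))
... | false = ∑∈-const (s ∘ suc) c

∑∈-pos : ∀ (s : Fin n → Bool) h → 0 < ∑∈ s h → ∃ λ x → s x ≡ true × 0 < h x
∑∈-pos {suc n} s h pos with s zero in s0 | h zero in h0
... | true | suc _ = zero , s0 , subst (0 <_) (sym h0) (s≤s z≤n)
... | true | zero with ∑∈-pos (s ∘ suc) (h ∘ suc) pos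
...   | x , sx , hx = suc x , sx , hx
∑∈-pos {suc n} s h pos | false | _ with ∑∈-pos (s ∘ suc) (h ∘ suc) pos
...   | x , sx , hx = suc x , sx , hx

count-remove : ∀ (s : Fin n → Bool) x → s x ≡ true → count s ≡ suc (count (s - x))
count-remove s x sx = trans (∑∈-remove s x (const 1) sx) (+-comm (count (s - x)) 1)

∈⇒count-pos : ∀ (s : Fin n → Bool) x → s x ≡ true → 0 < count s
∈⇒count-pos s x sx = subst (0 <_) (sym (count-remove s x sx)) (s≤s z≤n)

count≤n : ∀ (s : Fin n → Bool) → count s ≤ n
count≤n {zero}  s = z≤n
count≤n {suc n} s with s zero
... | true  = s≤s (count≤n (s ∘ suc))
... | false = m≤n⇒m≤1+n (count≤n (s ∘ suc))

count-mono : ∀ (s t : Fin n → Bool) → (∀ i → s i ≡ true → t i ≡ true) → count s ≤ count t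
count-mono s t s⊆t = ∑-mono-≤ pointwise
  where
  pointwise : ∀ i → (if s i then 1 else 0) ≤ (if t i then 1 else 0)
  pointwise i with s i in si
  ... | true rewrite s⊆t i si = ≤-refl
  ... | false = z≤n

count-∁ : ∀ (s : Fin n → Bool) → count (not ∘ s) + count s ≡ n
count-∁ {zero}  s = refl
count-∁ {suc n} s with s zero
... | true  = trans (+-suc _ _) (cong suc (count-∁ (s ∘ suc)))
... | false = cong suc (count-∁ (s ∘ suc))

count-split : ∀ (t s : Fin n → Bool) → count t ≤ count (λ i → t i ∧ s i) + count (not ∘ s)
count-split t s =
  ≤-trans (∑-mono-≤ pointwise)
          (≤-reflexive (∑-distrib-+ (λ i → if t i ∧ s i then 1 else 0) (λ i → if not (s i) then 1 else 0)))
  where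
  pointwise : ∀ i → (if t i then 1 else 0) ≤ (if t i ∧ s i then 1 else 0) + (if not (s i) then 1 else 0)
  pointwise i with t i | s i
  ... | true  | true  = ≤-refl
  ... | true  | false = ≤-refl
  ... | false | _     = z≤n

two-members : ∀ (s : Fin n → Bool) → 2 ≤ count s → ∃₂ λ x y → x ≢ y × s x ≡ true × s y ≡ true
two-members s 2≤count with ∑∈-pos s (const 1) (≤-trans (s≤s z≤n) 2≤count)
... | x , sx , _ with ∑∈-pos (s - x) (const 1) (s≤s⁻¹ (subst (2 ≤_) (count-remove s x sx) 2≤count))
...   | y , s-x-y , _ = x , y , ≢-sym (∈-⇒≢ s x y s-x-y) , sx , ∈-⇒∈ s x y s-x-y

count≡1⇒unique : ∀ (s : Fin n → Bool) → count s ≡ 1 → ∀ {x y} → s x ≡ true → s y ≡ true → x ≡ y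
count≡1⇒unique s count≡1 {x} {y} sx sy with x ≟ᶠ y
... | yes x≡y = x≡y
... | no x≢y  = contradiction (subst (0 <_) count-s-x≡0 (∈⇒count-pos (s - x) y s-x-y)) λ ()
  where
  count-s-x≡0 : count (s - x) ≡ 0
  count-s-x≡0 = suc-injective (trans (sym (count-remove s x sx)) count≡1)
  s-x-y : (s - x) y ≡ true
  s-x-y = ∈∧≢⇒∈- s x y sy (≢-sym x≢y)

countTrue≡count : ∀ (s : Fin n → Bool) → countTrue s ≡ count s
countTrue≡count {zero}  s = refl
countTrue≡count {suc n} s with s zero
... | true  = cong suc (countTrue≡count (s ∘ suc))
... | false = countTrue≡count (s ∘ suc)

∣∣≡count : ∀ (S : Subset n) → ∣ S ∣ ≡ count (lookup S)
∣∣≡count []          = refl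
∣∣≡count (true ∷ S)  = cong suc (∣∣≡count S)
∣∣≡count (false ∷ S) = ∣∣≡count S

-- Cycles and non-backtracking walks

record Cycle {V : Set} (R : V → V → Set) (P : V → Set) : Set where
  field
    k     : ℕ
    v     : Fin (suc (suc (suc k))) → V
    inj   : Injective _≡_ _≡_ v
    inP   : ∀ i → P (v i)
    step  : ∀ (i : Fin (suc (suc k))) → R (v (inject₁ i)) (v (suc i))
    close : R (v (fromℕ (suc (suc k)))) (v zero)

Cycle-map : ∀ {V W : Set} {R : V → V → Set} {P : V → Set} {R′ : W → W → Set} {P′ : W → Set}
            (f : V → W) → Injective _≡_ _≡_ f → (∀ {u w} → R u w → R′ (f u) (f w)) → (∀ {u} → P u → P′ (f u)) →
            Cycle R P → Cycle R′ P′
Cycle-map f f-inj f-R f-P c = record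
  { k = k ; v = f ∘ v ; inj = inj ∘ f-inj ; inP = f-P ∘ inP ; step = f-R ∘ step ; close = f-R close }
  where open Cycle c

Cycle-mono : ∀ {V : Set} {R : V → V → Set} {P Q : V → Set} → (∀ {u} → P u → Q u) → Cycle R P → Cycle R Q
Cycle-mono P⊆Q = Cycle-map id id id P⊆Q

MinDegree≥2 : ∀ {V : Set} → (V → V → Set) → (V → Set) → Set
MinDegree≥2 {V} R P = ∀ {u} → P u → ∃₂ λ (w w′ : V) → w ≢ w′ × (R u w × P w) × (R u w′ × P w′)

record NonBacktrackingWalk {V : Set} (R : V → V → Set) (P : V → Set) : Set where
  field
    w               : ℕ → V
    adjacent        : ∀ t → R (w t) (w (suc t))
    inP             : ∀ t → P (w t)
    nonBacktracking : ∀ t → w (suc (suc t)) ≢ w t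

module _ {V : Set} {N : ℕ} (encode : V ↣ Fin N) where

  open Injection encode using (to; injective)

  DistinctBelow : (ℕ → V) → ℕ → Set
  DistinctBelow f j = ∀ {i i′} → i < j → i′ < j → f i ≡ f i′ → i ≡ i′

  record FirstRepeat (f : ℕ → V) : Set where
    field
      {i j}    : ℕ
      i<j      : i < j
      fi≡fj    : f i ≡ f j
      distinct : DistinctBelow f j

  distinctBelow-extend : ∀ {f j} → DistinctBelow f j → (∀ {i} → i < j → f i ≢ f j) → DistinctBelow f (suc j)
  distinctBelow-extend distinct new {i} {i′} i<1+j i′<1+j fi≡fi′
    with m<1+n⇒m<n∨m≡n i<1+j | m<1+n⇒m<n∨m≡n i′<1+j
  ... | inj₁ i<j  | inj₁ i′<j = distinct i<j i′<j fi≡fi′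
  ... | inj₁ i<j  | inj₂ refl = contradiction fi≡fi′ (new i<j)
  ... | inj₂ refl | inj₁ i′<j = contradiction (sym fi≡fi′) (new i′<j)
  ... | inj₂ refl | inj₂ refl = refl

  distinctBelow⊎firstRepeat : ∀ f j → DistinctBelow f j ⊎ FirstRepeat f
  distinctBelow⊎firstRepeat f zero = inj₁ λ ()
  distinctBelow⊎firstRepeat f (suc j) with distinctBelow⊎firstRepeat f j
  ... | inj₂ repeat   = inj₂ repeat
  ... | inj₁ distinct with anyUpTo? (λ i → inj⇒≟ encode (f i) (f j)) j
  ...   | yes (i , i<j , fi≡fj) = inj₂ (record { i<j = i<j ; fi≡fj = fi≡fj ; distinct = distinct })
  ...   | no no-repeat          = inj₁ (distinctBelow-extend distinct λ i<j fi≡fj → no-repeat (_ , i<j , fi≡fj))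

  ¬distinctBelow-suc : ∀ f → ¬ DistinctBelow f (suc N)
  ¬distinctBelow-suc f distinct with pigeonhole (n<1+n N) (to ∘ f ∘ toℕ)
  ... | i , j , i<j , eq = <-irrefl (distinct (toℕ<n i) (toℕ<n j) (injective eq)) i<j

  firstRepeat : ∀ f → FirstRepeat f
  firstRepeat f with distinctBelow⊎firstRepeat f (suc N)
  ... | inj₁ distinct = ⊥-elim (¬distinctBelow-suc f distinct)
  ... | inj₂ repeat   = repeat

module _ {V : Set} {N : ℕ} (encode : V ↣ Fin N) {R : V → V → Set} {P : V → Set} where

  neighbour-avoiding : MinDegree≥2 R P → ∀ {u} → P u → (z : V) → ∃ λ w → R u w × P w × w ≢ z
  neighbour-avoiding δ₂ Pu z with δ₂ Pu
  ... | w , w′ , w≢w′ , (Ruw , Pw) , (Ruw′ , Pw′) with inj⇒≟ encode w z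
  ...   | yes refl = w′ , Ruw′ , Pw′ , w≢w′ ∘ sym
  ...   | no w≢z   = w , Ruw , Pw , w≢z

  minDegree≥2⇒walk : MinDegree≥2 R P → ∀ {u} → P u → NonBacktrackingWalk R P
  minDegree≥2⇒walk δ₂ {u} Pu = record
    { w = from ∘ arcs ; adjacent = adjacent ∘ arcs ; inP = from∈ ∘ arcs ; nonBacktracking = continue-≢-from ∘ arcs }
    where
    record Arc : Set where
      constructor arc
      field
        {from to} : V
        adjacent  : R from to
        from∈     : P from
        to∈       : P to
    open Arc

    next : (a : Arc) → ∃ λ w → R (to a) w × P w × w ≢ from a
    next a = neighbour-avoiding δ₂ (to∈ a) (from a)

    continue : Arc → Arc
    continue a = arc (proj₁ (proj₂ (next a))) (to∈ a) (proj₁ (proj₂ (proj₂ (next a))))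

    continue-≢-from : ∀ a → to (continue a) ≢ from a
    continue-≢-from a = proj₂ (proj₂ (proj₂ (next a)))

    first : ∃ λ w → R u w × P w × w ≢ u
    first = neighbour-avoiding δ₂ Pu u

    arcs : ℕ → Arc
    arcs zero    = arc (proj₁ (proj₂ first)) Pu (proj₁ (proj₂ (proj₂ first)))
    arcs (suc t) = continue (arcs t)

  module _ (R-irrefl : ∀ {u} → ¬ R u u) (W : NonBacktrackingWalk R P) where
    open NonBacktrackingWalk W

    segment-cycle : ∀ i k → let j = i + suc (suc (suc k)) in w i ≡ w j → DistinctBelow encode w j → Cycle R P
    segment-cycle i k wi≡wj distinct = record
      { k = k ; v = v ; inj = v-injective ; inP = λ t → inP (i + toℕ t) ; step = v-step ; close = v-close }
      where
      v : Fin (suc (suc (suc k))) → V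
      v t = w (i + toℕ t)
      v-injective : Injective _≡_ _≡_ v
      v-injective {t} {t′} eq =
        toℕ-injective (+-cancelˡ-≡ i _ _ (distinct (+-monoʳ-< i (toℕ<n t)) (+-monoʳ-< i (toℕ<n t′)) eq))
      v-step : ∀ t → R (v (inject₁ t)) (v (suc t))
      v-step t rewrite toℕ-inject₁ t | +-suc i (toℕ t) = adjacent (i + toℕ t)
      v-close : R (v (fromℕ (suc (suc k)))) (v zero)
      v-close rewrite toℕ-fromℕ (suc (suc k)) | +-identityʳ i | wi≡wj | +-suc i (suc (suc k)) =
        adjacent (i + suc (suc k))

    repeat⇒cycle : ∀ {i j} → i < j → w i ≡ w j → DistinctBelow encode w j → Cycle R P
    repeat⇒cycle {i} i<j wi≡wj distinct with m≤n⇒∃[o]m+o≡n i<j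
    ... | zero , refl =
      contradiction (subst (R (w i)) (sym (trans wi≡wj (cong (w ∘ suc) (+-identityʳ i)))) (adjacent i)) R-irrefl
    ... | suc zero , refl =
      contradiction (sym (trans wi≡wj (cong (w ∘ suc) (+-comm i 1)))) (nonBacktracking i)
    ... | suc (suc k) , refl rewrite sym (+-suc i (suc (suc k))) = segment-cycle i k wi≡wj distinct

    walk⇒cycle : Cycle R P
    walk⇒cycle = repeat⇒cycle i<j fi≡fj distinct
      where open FirstRepeat (firstRepeat encode w)

-- Induced subgraphs of a bipartite graph

transpose : BipGraph n → BipGraph n
transpose B a b = B b a

InSᵇ : (Fin n → Bool) → (Fin n → Bool) → Vertex n → Set
InSᵇ s₁ s₂ (inj₁ a) = s₁ a ≡ true
InSᵇ s₁ s₂ (inj₂ b) = s₂ b ≡ true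

degreeIn : BipGraph n → (Fin n → Bool) → Fin n → ℕ
degreeIn B s₂ a = count (λ b → B a b ∧ s₂ b)

edges : BipGraph n → (Fin n → Bool) → (Fin n → Bool) → ℕ
edges B s₁ s₂ = ∑∈ s₁ (degreeIn B s₂)

Adj-irrefl : ∀ (B : BipGraph n) {u} → ¬ Adj B u u
Adj-irrefl B {inj₁ _} ()
Adj-irrefl B {inj₂ _} ()

encodeVertex : Vertex n ↣ Fin (n + n)
encodeVertex = ↔⇒↣ (↔-sym +↔⊎)

Cycle-transpose : ∀ {B : BipGraph n} {s₁ s₂} → Cycle (Adj (transpose B)) (InSᵇ s₂ s₁) → Cycle (Adj B) (InSᵇ s₁ s₂)
Cycle-transpose {B = B} {s₁} {s₂} = Cycle-map swap (Injection.injective (↔⇒↣ swap-↔)) swap-Adj swap-InSᵇ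
  where
  swap-Adj : ∀ {u w} → Adj (transpose B) u w → Adj B (swap u) (swap w)
  swap-Adj {inj₁ _} {inj₂ _} = id
  swap-Adj {inj₂ _} {inj₁ _} = id
  swap-InSᵇ : ∀ {u} → InSᵇ s₂ s₁ u → InSᵇ s₁ s₂ (swap u)
  swap-InSᵇ {inj₁ _} = id
  swap-InSᵇ {inj₂ _} = id

if-count≡count-∧ : ∀ b (s : Fin n → Bool) → (if b then count s else 0) ≡ count (λ i → b ∧ s i)
if-count≡count-∧     true  s = refl
if-count≡count-∧ {n} false s = sym (sum-replicate-zero n)

∧-reverse : ∀ a b c → a ∧ (b ∧ c) ≡ c ∧ (b ∧ a)
∧-reverse a b c = begin
  a ∧ (b ∧ c) ≡⟨ ∧-comm a (b ∧ c) ⟩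
  (b ∧ c) ∧ a ≡⟨ cong (_∧ a) (∧-comm b c) ⟩
  (c ∧ b) ∧ a ≡⟨ ∧-assoc c b a ⟩
  c ∧ (b ∧ a) ∎
  where open ≡-Reasoning

edges-transpose : ∀ (B : BipGraph n) s₁ s₂ → edges B s₁ s₂ ≡ edges (transpose B) s₂ s₁
edges-transpose {n} B s₁ s₂ = begin
  edges B s₁ s₂                                  ≡⟨ sum-cong-≗ (λ a → if-count≡count-∧ (s₁ a) (λ b → B a b ∧ s₂ b)) ⟩
  ∑[ a < n ] ∑[ b < n ] edge-in-S a b            ≡⟨ ∑-comm edge-in-S ⟩
  ∑[ b < n ] ∑[ a < n ] edge-in-S a b            ≡⟨ sum-cong-≗ (λ b → sum-cong-≗ λ a → cong (if_then 1 else 0)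
                                                                                      (∧-reverse (s₁ a) (B a b) (s₂ b))) ⟩
  ∑[ b < n ] count (λ a → s₂ b ∧ (B a b ∧ s₁ a)) ≡⟨ sum-cong-≗ (λ b → if-count≡count-∧ (s₂ b) (λ a → B a b ∧ s₁ a)) ⟨
  edges (transpose B) s₂ s₁                      ∎
  where
  open ≡-Reasoning
  edge-in-S : Fin n → Fin n → ℕ
  edge-in-S a b = if s₁ a ∧ (B a b ∧ s₂ b) then 1 else 0

degreeIn≤count : ∀ (B : BipGraph n) s₂ a → degreeIn B s₂ a ≤ count s₂
degreeIn≤count B s₂ a = count-mono _ s₂ (λ b → ∧-conicalʳ (B a b) (s₂ b))

edges-pos⇒2≤size : ∀ (B : BipGraph n) s₁ s₂ → 0 < edges B s₁ s₂ → 2 ≤ count s₁ + count s₂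
edges-pos⇒2≤size B s₁ s₂ pos with ∑∈-pos s₁ (degreeIn B s₂) pos
... | a , a∈ , deg-pos = +-mono-≤ (∈⇒count-pos s₁ a a∈) (≤-trans deg-pos (degreeIn≤count B s₂ a))

edges-lower-bound : ∀ (B : BipGraph n) s₁ s₂ {K r} → (∀ a → s₁ a ≡ true → K ≤ degreeIn B s₂ a + r) →
                    K * count s₁ ≤ edges B s₁ s₂ + r * count s₁
edges-lower-bound B s₁ s₂ {K} {r} bound = begin
  K * count s₁                      ≡⟨ ∑∈-const s₁ K ⟨
  ∑∈ s₁ (const K)                   ≤⟨ ∑∈-mono-≤ s₁ bound ⟩
  ∑∈ s₁ (λ a → degreeIn B s₂ a + r) ≡⟨ ∑∈-+ s₁ (degreeIn B s₂) (const r) ⟩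
  edges B s₁ s₂ + ∑∈ s₁ (const r)   ≡⟨ cong (edges B s₁ s₂ +_) (∑∈-const s₁ r) ⟩
  edges B s₁ s₂ + r * count s₁      ∎
  where open ≤-Reasoning

Leaf : BipGraph n → (Fin n → Bool) → (Fin n → Bool) → Fin n → Set
Leaf B s₁ s₂ a = s₁ a ≡ true × degreeIn B s₂ a ≤ 1

removeLeaf : ∀ (B : BipGraph n) s₁ s₂ {a v} → Leaf B s₁ s₂ a →
             count s₁ + count s₂ ≡ suc (suc v) → suc (suc v) ≤ edges B s₁ s₂ →
             count (s₁ - a) + count s₂ ≡ suc v × suc v ≤ edges B (s₁ - a) s₂
removeLeaf B s₁ s₂ {a} {v} (a∈ , leaf) size dense =
  suc-injective (trans (cong (_+ count s₂) (sym (count-remove s₁ a a∈))) size) , s≤s⁻¹ dense′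
  where
  open ≤-Reasoning
  dense′ : suc (suc v) ≤ suc (edges B (s₁ - a) s₂)
  dense′ = begin
    suc (suc v)                           ≤⟨ dense ⟩
    edges B s₁ s₂                         ≡⟨ ∑∈-remove s₁ a (degreeIn B s₂) a∈ ⟩
    edges B (s₁ - a) s₂ + degreeIn B s₂ a ≤⟨ +-monoʳ-≤ (edges B (s₁ - a) s₂) leaf ⟩
    edges B (s₁ - a) s₂ + 1               ≡⟨ +-comm (edges B (s₁ - a) s₂) 1 ⟩
    suc (edges B (s₁ - a) s₂)             ∎

leafless⇒minDegree≥2 : ∀ (B : BipGraph n) s₁ s₂ → ¬ ∃ (Leaf B s₁ s₂) → ¬ ∃ (Leaf (transpose B) s₂ s₁) →
                       MinDegree≥2 (Adj B) (InSᵇ s₁ s₂)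
leafless⇒minDegree≥2 B s₁ s₂ no-leaf₁ no-leaf₂ {inj₁ a} a∈
  with two-members _ (≰⇒> λ leaf → no-leaf₁ (a , a∈ , leaf))
... | b , b′ , b≢b′ , e , e′ =
  inj₂ b , inj₂ b′ , b≢b′ ∘ inj₂-injective ,
  (∧-conicalˡ _ _ e , ∧-conicalʳ _ _ e) , (∧-conicalˡ _ _ e′ , ∧-conicalʳ _ _ e′)
leafless⇒minDegree≥2 B s₁ s₂ no-leaf₁ no-leaf₂ {inj₂ b} b∈
  with two-members _ (≰⇒> λ leaf → no-leaf₂ (b , b∈ , leaf))
... | a , a′ , a≢a′ , e , e′ =
  inj₁ a , inj₁ a′ , a≢a′ ∘ inj₁-injective ,
  (∧-conicalˡ _ _ e , ∧-conicalʳ _ _ e) , (∧-conicalˡ _ _ e′ , ∧-conicalʳ _ _ e′)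

InSᵇ-remove₁ : ∀ (s₁ s₂ : Fin n → Bool) a {u} → InSᵇ (s₁ - a) s₂ u → InSᵇ s₁ s₂ u
InSᵇ-remove₁ s₁ s₂ a {inj₁ x} = ∈-⇒∈ s₁ a x
InSᵇ-remove₁ s₁ s₂ a {inj₂ y} = id

InSᵇ-remove₂ : ∀ (s₁ s₂ : Fin n → Bool) b {u} → InSᵇ s₁ (s₂ - b) u → InSᵇ s₁ s₂ u
InSᵇ-remove₂ s₁ s₂ b {inj₁ x} = id
InSᵇ-remove₂ s₁ s₂ b {inj₂ y} = ∈-⇒∈ s₂ b y

edges≥vertices⇒cycle : ∀ v (B : BipGraph n) s₁ s₂ → count s₁ + count s₂ ≡ suc v → suc v ≤ edges B s₁ s₂ →
                       Cycle (Adj B) (InSᵇ s₁ s₂)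
edges≥vertices⇒cycle zero B s₁ s₂ size dense with subst (2 ≤_) size (edges-pos⇒2≤size B s₁ s₂ dense)
... | s≤s ()
edges≥vertices⇒cycle (suc v) B s₁ s₂ size dense
  with any? (λ a → (s₁ a ≟ᵇ true) ×-dec (degreeIn B s₂ a ≤? 1))
... | yes (a , leaf) =
  let size′ , dense′ = removeLeaf B s₁ s₂ leaf size dense
  in Cycle-mono (InSᵇ-remove₁ s₁ s₂ a) (edges≥vertices⇒cycle v B (s₁ - a) s₂ size′ dense′)
... | no no-leaf₁ with any? (λ b → (s₂ b ≟ᵇ true) ×-dec (degreeIn (transpose B) s₁ b ≤? 1))
...   | yes (b , leaf) =
  let size′ , dense′ = removeLeaf (transpose B) s₂ s₁ leaf (trans (+-comm (count s₂) (count s₁)) size)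
                         (subst (suc (suc v) ≤_) (edges-transpose B s₁ s₂) dense)
  in Cycle-mono (InSᵇ-remove₂ s₁ s₂ b)
       (edges≥vertices⇒cycle v B s₁ (s₂ - b) (trans (+-comm (count s₁) (count (s₂ - b))) size′)
                                             (subst (suc v ≤_) (sym (edges-transpose B s₁ (s₂ - b))) dense′))
...   | no no-leaf₂ with ∑∈-pos s₁ (degreeIn B s₂) (≤-trans (s≤s z≤n) dense)
...     | a , a∈ , _ = walk⇒cycle encodeVertex (Adj-irrefl B) (minDegree≥2⇒walk encodeVertex δ₂ {inj₁ a} a∈)
  where δ₂ = leafless⇒minDegree≥2 B s₁ s₂ no-leaf₁ no-leaf₂

Adj⇒endpoint∈V₂ : ∀ (B : BipGraph n) {u w} → Adj B u w → (∃ λ b → u ≡ inj₂ b) ⊎ (∃ λ b → w ≡ inj₂ b)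
Adj⇒endpoint∈V₂ B {inj₁ _} {inj₂ b} _ = inj₂ (b , refl)
Adj⇒endpoint∈V₂ B {inj₂ b} {inj₁ _} _ = inj₁ (b , refl)

module _ (B : BipGraph n) (s₁ s₂ : Fin n → Bool) (unique : ∀ {a a′} → s₁ a ≡ true → s₁ a′ ≡ true → a ≡ a′) where

  common-V₂-neighbour : ∀ {u m w b} → m ≡ inj₂ b → Adj B u m → Adj B m w → InSᵇ s₁ s₂ u → InSᵇ s₁ s₂ w → u ≡ w
  common-V₂-neighbour {inj₁ a} {w = inj₁ a′} refl _ _ a∈ a′∈ = cong inj₁ (unique a∈ a′∈)
  common-V₂-neighbour {inj₂ _} refl () _
  common-V₂-neighbour {inj₁ _} {w = inj₂ _} refl _ ()

  -- v₀ or v₁ lies in V₂, and its two neighbours on the cycle would be equal.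
  leftUnique⇒acyclic : ¬ Cycle (Adj B) (InSᵇ s₁ s₂)
  leftUnique⇒acyclic c = [ at-v₀ , at-v₁ ]′ (Adj⇒endpoint∈V₂ B (step 0F))
    where
    open Cycle c
    at-v₀ : ∃ (λ b → v 0F ≡ inj₂ b) → ⊥
    at-v₀ (b , v₀≡b) = contradiction (inj (common-V₂-neighbour v₀≡b close (step 0F) (inP _) (inP 1F))) λ ()
    at-v₁ : ∃ (λ b → v 1F ≡ inj₂ b) → ⊥
    at-v₁ (b , v₁≡b) = contradiction (inj (common-V₂-neighbour v₁≡b (step 0F) (step 1F) (inP 0F) (inP 2F))) λ ()

-- Odd n = 1 + m * 2 and minimum degree at least n/2 + 1

1+m*2+2≤2*d⇒2+m≤d : ∀ m d → suc (m * 2) + 2 ≤ 2 * d → 2 + m ≤ d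
1+m*2+2≤2*d⇒2+m≤d m d deg = *-cancelˡ-< 2 (suc m) d (subst (_≤ 2 * d) (identity m) deg)
  where
  identity : ∀ m → suc (m * 2) + 2 ≡ suc (2 * suc m)
  identity = solve-∀

m≤n∧m+n≡[1+o]*2⇒m≤1+o : ∀ {a b m} → a ≤ b → a + b ≡ suc m * 2 → a ≤ suc m
m≤n∧m+n≡[1+o]*2⇒m≤1+o {a} {b} {m} a≤b a+b≡ = *-cancelʳ-≤ a (suc m) 2 (begin
  a * 2     ≡⟨ identity a ⟩
  a + a     ≤⟨ +-monoʳ-≤ a a≤b ⟩
  a + b     ≡⟨ a+b≡ ⟩
  suc m * 2 ∎)
  where
  open ≤-Reasoning
  identity : ∀ a → a * 2 ≡ a + a
  identity = solve-∀

-- (2 + m)(1 + r) − r(1 + r) = (1 + r)(2 + m − r) ≥ 2(1 + m), because (r − 1)(m − r) ≥ 0.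
concavity-bound : ∀ {m r e} → 1 ≤ r → r ≤ m → (2 + m) * suc r ≤ e + r * suc r → suc m * 2 ≤ e
concavity-bound {m} {suc p} {e} _ r≤m dense with m≤n⇒∃[o]m+o≡n r≤m
... | q , refl = begin
  suc (suc p + q) * 2         ≤⟨ m≤m+n _ (p * q) ⟩
  suc (suc p + q) * 2 + p * q ≡⟨ identity₁ p q ⟩
  (2 + q) * suc (suc p)       ≤⟨ +-cancelʳ-≤ (suc p * suc (suc p)) _ _ dense′ ⟩
  e                           ∎
  where
  open ≤-Reasoning
  identity₁ : ∀ p q → suc (suc p + q) * 2 + p * q ≡ (2 + q) * suc (suc p)
  identity₁ = solve-∀
  identity₂ : ∀ p q → (2 + (suc p + q)) * suc (suc p) ≡ (2 + q) * suc (suc p) + suc p * suc (suc p)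
  identity₂ = solve-∀
  dense′ : (2 + q) * suc (suc p) + suc p * suc (suc p) ≤ e + suc p * suc (suc p)
  dense′ = subst (_≤ e + suc p * suc (suc p)) (identity₂ p q) dense

smaller-side≥2⇒cycle : ∀ m (B : BipGraph (suc (m * 2))) → MinDegreeAtLeastHalfPlusOne B → ∀ s₁ s₂ →
                       2 ≤ count s₁ → count s₁ ≤ count s₂ → count s₁ + count s₂ ≡ suc m * 2 →
                       Cycle (Adj B) (InSᵇ s₁ s₂)
smaller-side≥2⇒cycle m B δ s₁ s₂ 2≤a a≤b size =
  edges≥vertices⇒cycle (suc (m * 2)) B s₁ s₂ size (concavity-bound 1≤r r≤m dense)
  where
  r = count (not ∘ s₂)
  a≡1+r : count s₁ ≡ suc r
  a≡1+r = +-cancelʳ-≡ (count s₂) (count s₁) (suc r) (trans size (cong suc (sym (count-∁ s₂))))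
  1≤r : 1 ≤ r
  1≤r = s≤s⁻¹ (subst (2 ≤_) a≡1+r 2≤a)
  r≤m : r ≤ m
  r≤m = s≤s⁻¹ (subst (_≤ suc m) a≡1+r (m≤n∧m+n≡[1+o]*2⇒m≤1+o a≤b size))
  degree-bound : ∀ a → s₁ a ≡ true → 2 + m ≤ degreeIn B s₂ a + r
  degree-bound a _ = begin
    2 + m               ≤⟨ 1+m*2+2≤2*d⇒2+m≤d m _ (δ (inj₁ a)) ⟩
    degree B (inj₁ a)   ≡⟨ countTrue≡count (B a) ⟩
    count (B a)         ≤⟨ count-split (B a) s₂ ⟩
    degreeIn B s₂ a + r ∎
    where open ≤-Reasoning
  dense : (2 + m) * suc r ≤ edges B s₁ s₂ + r * suc r
  dense = subst (λ a → (2 + m) * a ≤ edges B s₁ s₂ + r * a) a≡1+r (edges-lower-bound B s₁ s₂ degree-bound)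

minDegree-transpose : {B : BipGraph n} → MinDegreeAtLeastHalfPlusOne B → MinDegreeAtLeastHalfPlusOne (transpose B)
minDegree-transpose δ (inj₁ a) = δ (inj₂ a)
minDegree-transpose δ (inj₂ b) = δ (inj₁ b)

m+n≡1+o∧n≤o⇒1≤m : ∀ {a b n} → a + b ≡ suc n → b ≤ n → 1 ≤ a
m+n≡1+o∧n≤o⇒1≤m {zero}  refl b≤n = contradiction b≤n (<-irrefl refl)
m+n≡1+o∧n≤o⇒1≤m {suc a} _    _   = s≤s z≤n

m⊓n≢1⇒2≤m : ∀ {a b} → 1 ≤ a → 1 ≤ b → a ⊓ b ≢ 1 → 2 ≤ a
m⊓n≢1⇒2≤m {suc zero}    _ 1≤b min≢1 = contradiction (m≤n⇒m⊓n≡m 1≤b) min≢1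
m⊓n≢1⇒2≤m {suc (suc a)} _ _   _     = s≤s (s≤s z≤n)

min≢1⇒cycle : ∀ m (B : BipGraph (suc (m * 2))) → MinDegreeAtLeastHalfPlusOne B → ∀ s₁ s₂ →
              count s₁ + count s₂ ≡ suc m * 2 → count s₁ ⊓ count s₂ ≢ 1 → Cycle (Adj B) (InSᵇ s₁ s₂)
min≢1⇒cycle m B δ s₁ s₂ size min≢1 = [ smaller-left , smaller-right ]′ (≤-total (count s₁) (count s₂))
  where
  size′ = trans (+-comm (count s₂) (count s₁)) size
  1≤a = m+n≡1+o∧n≤o⇒1≤m size (count≤n s₂)
  1≤b = m+n≡1+o∧n≤o⇒1≤m size′ (count≤n s₁)
  smaller-left : count s₁ ≤ count s₂ → Cycle (Adj B) (InSᵇ s₁ s₂)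
  smaller-left a≤b = smaller-side≥2⇒cycle m B δ s₁ s₂ (m⊓n≢1⇒2≤m 1≤a 1≤b min≢1) a≤b size
  smaller-right : count s₂ ≤ count s₁ → Cycle (Adj B) (InSᵇ s₁ s₂)
  smaller-right b≤a = Cycle-transpose (smaller-side≥2⇒cycle m (transpose B) (minDegree-transpose δ) s₂ s₁
                        (m⊓n≢1⇒2≤m 1≤b 1≤a (min≢1 ∘ trans (⊓-comm (count s₁) (count s₂)))) b≤a size′)

min≡1⇒acyclic : ∀ (B : BipGraph n) s₁ s₂ → count s₁ ⊓ count s₂ ≡ 1 → ¬ Cycle (Adj B) (InSᵇ s₁ s₂)
min≡1⇒acyclic B s₁ s₂ min≡1 with ⊓-sel (count s₁) (count s₂)
... | inj₁ min≡a = leftUnique⇒acyclic B s₁ s₂ (count≡1⇒unique s₁ (trans (sym min≡a) min≡1))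
... | inj₂ min≡b =
  leftUnique⇒acyclic (transpose B) s₂ s₁ (count≡1⇒unique s₂ (trans (sym min≡b) min≡1)) ∘ Cycle-transpose

module _ (B : BipGraph n) (S₁ S₂ : Subset n) where

  InS⇒InSᵇ : ∀ {u} → InS S₁ S₂ u → InSᵇ (lookup S₁) (lookup S₂) u
  InS⇒InSᵇ {inj₁ _} = []=⇒lookup
  InS⇒InSᵇ {inj₂ _} = []=⇒lookup

  InSᵇ⇒InS : ∀ {u} → InSᵇ (lookup S₁) (lookup S₂) u → InS S₁ S₂ u
  InSᵇ⇒InS {inj₁ a} = lookup⇒[]= a S₁
  InSᵇ⇒InS {inj₂ b} = lookup⇒[]= b S₂

  CycleIn⇒Cycle : CycleIn B S₁ S₂ → Cycle (Adj B) (InSᵇ (lookup S₁) (lookup S₂))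
  CycleIn⇒Cycle c = record { k = k ; v = v ; inj = inj ; inP = InS⇒InSᵇ ∘ inS ; step = step ; close = close }
    where open CycleIn c

  Cycle⇒CycleIn : Cycle (Adj B) (InSᵇ (lookup S₁) (lookup S₂)) → CycleIn B S₁ S₂
  Cycle⇒CycleIn c = record { k = k ; v = v ; inj = inj ; inS = InSᵇ⇒InS ∘ inP ; step = step ; close = close }
    where open Cycle c

n%2≡1⇒n≡1+m*2 : ∀ n → n % 2 ≡ 1 → ∃ λ m → n ≡ suc (m * 2)
n%2≡1⇒n≡1+m*2 n odd = n / 2 , trans (m≡m%n+[m/n]*n n 2) (cong (_+ n / 2 * 2) odd)

corollary1 : (n : ℕ) → n % 2 ≡ 1 → (B : BipGraph n) → MinDegreeAtLeastHalfPlusOne B →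
    (S₁ S₂ : Subset n) → ∣ S₁ ∣ + ∣ S₂ ∣ ≡ n + 1 →
    (IsForest B S₁ S₂ ⇔ (∣ S₁ ∣ ⊓ ∣ S₂ ∣ ≡ 1))
corollary1 n odd B δ S₁ S₂ size with n%2≡1⇒n≡1+m*2 n odd
... | m , refl rewrite ∣∣≡count S₁ | ∣∣≡count S₂ = mk⇔
  (λ forest → decidable-stable (count (lookup S₁) ⊓ count (lookup S₂) ≟ 1)
                (forest ∘ Cycle⇒CycleIn B S₁ S₂ ∘ min≢1⇒cycle m B δ _ _ (trans size (+-comm _ 1))))
  (λ min≡1 → min≡1⇒acyclic B _ _ min≡1 ∘ CycleIn⇒Cycle B S₁ S₂)
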